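{- Let $r$ be a nonnegative integer. Let $\mathbf{a}=(a_1,a_2,\ldots)$ be a sequence of real numbers with $a_1\neq 0$, let $A(t)=\sum_{j\ge1}a_j\frac{t^j}{j!}$, let $\overline{A}(t)=\sum_{j\ge1}\overline{a}_j\frac{t^j}{j!}$ be the compositional inverse of $A$, and $\overline{\mathbf{a}}=(\overline{a}_1,\overline{a}_2,\ldots)$. Let $\mathbf{b}=(b_1,b_2,\ldots)$ be a sequence of real numbers with $b_1\neq0$, let $B(t)=\sum_{j\ge0}b_{j+1}\frac{t^j}{j!}$, and let $(\mathbf{b}\circ\overline{\mathbf{a}})^{ -1}=(c_1,c_2,\ldots)$ be the sequence defined by $\sum_{j\ge0}c_{j+1}\frac{t^j}{j!}=\big(B(\overline{A}(t))\big)^{ -1}$. Then for sequences of real numbers $(U_n)_{n\ge0}$, $(V_n)_{n\ge0}$ the following inverse relations hold: $$U_n=\sum_{k=0}^{n}B^{(r)}_{n+r,k+r}(\mathbf{a};\mathbf{b})V_k\ \text{ for all } n\ge0 \iff V_n=\sum_{k=0}^{n}B^{(r)}_{n+r,k+r}\big(\overline{\mathbf{a}};(\mathbf{b}\circ\overline{\mathbf{a}})^{ -1}\big)U_k\ \text{ for all } n\ge0,$$ i.e. for all integers $0\le j\le n$, $$\sum_{k=j}^{n}B^{(r)}_{n+r,k+r}(\mathbf{a};\mathbf{b})\,B^{(r)}_{k+r,j+r}\big(\overline{\mathbf{a}};(\mathbf{b}\circ\overline{\mathbf{a}})^{ -1}\big)=\delta_{j,n}.$$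
   Context: For sequences $\mathbf{a}=(a_1,a_2,\ldots)$, $\mathbf{b}=(b_1,b_2,\ldots)$ and a nonnegative integer $r$, the partial $r$-Bell polynomials $B^{(r)}_{n+r,k+r}(\mathbf{a};\mathbf{b})$ ($n,k\ge0$) are defined by $$\sum_{n\ge k}B^{(r)}_{n+r,k+r}(\mathbf{a};\mathbf{b})\frac{t^n}{n!}=\frac{1}{k!}\Big(\sum_{j\ge1}a_j\frac{t^j}{j!}\Big)^k\Big(\sum_{j\ge0}b_{j+1}\frac{t^j}{j!}\Big)^r,$$ with $B^{(r)}_{n+r,k+r}(\mathbf{a};\mathbf{b})=0$ for $n<k$. $\delta_{j,n}$ is the Kronecker delta. -}

module Defs where

open import Level using (Level; _⊔_) renaming (suc to lsuc)
open import Data.Nat using (ℕ; zero; suc; _∸_; _≟_; _!) renaming (_+_ to _+ℕ_)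
open import Data.Bool using (if_then_else_)
open import Relation.Nullary using (¬_)
open import Relation.Nullary.Decidable using (⌊_⌋)
open import Algebra.Bundles using (CommutativeRing)

-- A field of characteristic zero (stand-in for ℝ, which agda-stdlib lacks).
natToRing : ∀ {c ℓ} (R : CommutativeRing c ℓ) → ℕ → CommutativeRing.Carrier R
natToRing R zero = CommutativeRing.0# R
natToRing R (suc n) = CommutativeRing._+_ R (CommutativeRing.1# R) (natToRing R n)

record Char0Field (c ℓ : Level) : Set (lsuc (c ⊔ ℓ)) where
  field
    commutativeRing : CommutativeRing c ℓ
  open CommutativeRing commutativeRing public
  ι : ℕ → Carrier
  ι = natToRing commutativeRing
  field
    _⁻¹       : Carrier → Carrier
    ⁻¹-inverse : ∀ x → ¬ (x ≈ 0#) → (x * (x ⁻¹)) ≈ 1#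
    0≉1       : ¬ (0# ≈ 1#)
    char0     : ∀ n → ¬ (ι (suc n) ≈ 0#)

module Theory {c ℓ : Level} (F : Char0Field c ℓ) where
  open Char0Field F using (Carrier; _≈_; _+_; _*_; 0#; 1#; _⁻¹; ι)

  sumUpTo : ℕ → (ℕ → Carrier) → Carrier
  sumUpTo zero f = f zero
  sumUpTo (suc n) f = sumUpTo n f + f (suc n)

  -- Σ_{k=j}^{n} f k   (only used with j ≤ n)
  sumFromTo : ℕ → ℕ → (ℕ → Carrier) → Carrier
  sumFromTo j n f = sumUpTo (n ∸ j) (λ i → f (j +ℕ i))

  δ : ℕ → ℕ → Carrier
  δ j n = if ⌊ j ≟ n ⌋ then 1# else 0#

  invFact : ℕ → Carrier
  invFact n = (ι (n !)) ⁻¹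

  -- formal power series, given by their ordinary coefficients: f n = [t^n] f
  PS : Set c
  PS = ℕ → Carrier

  one : PS
  one zero = 1#
  one (suc n) = 0#

  X : PS
  X zero = 0#
  X (suc zero) = 1#
  X (suc (suc n)) = 0#

  _⊛_ : PS → PS → PS
  (f ⊛ g) n = sumUpTo n (λ i → f i * g (n ∸ i))

  _^^_ : PS → ℕ → PS
  f ^^ zero = one
  f ^^ suc k = f ⊛ (f ^^ k)

  -- composition f(g(t)) (for g with zero constant term)
  _∘ₛ_ : PS → PS → PS
  (f ∘ₛ g) n = sumUpTo n (λ k → f k * (g ^^ k) n)

  -- sequences a = (a_1, a_2, ...) are modelled as ℕ → Carrier with a j = a_j
  -- (the value at index 0 is irrelevant)

  egfA : (ℕ → Carrier) → PS
  egfA a zero = 0#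
  egfA a (suc j) = a (suc j) * invFact (suc j)

  egfB : (ℕ → Carrier) → PS
  egfB b j = b (suc j) * invFact j

  -- partial r-Bell polynomial:  bellR r a b n k = B^{(r)}_{n+r,k+r}(a;b)
  --   = n! [t^n] (1/k!) A(t)^k B(t)^r      for n ≥ k, and 0 for n < k
  bellR : ℕ → (ℕ → Carrier) → (ℕ → Carrier) → ℕ → ℕ → Carrier
  bellR r a b n k =
    ι (n !) * (invFact k * (((egfA a) ^^ k) ⊛ ((egfB b) ^^ r)) n)

-- Write A, B, Ā, C for the series of a, b, ā, c. Expanding both Bell polynomials, the sum over k of
-- B(a;b)_{n,k} B(ā;c)_{k,j} is (n!/j!) [tⁿ] (Ā^j C^r)(A(t)) · B(t)^r, because Σ_k q_k A(t)^k is the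
-- composition Q(A(t)). As Ā(A(t)) = t and, composing C · B(Ā) = 1 with A, C(A(t)) · B(t) = 1, that series
-- is t^j, whose n-th coefficient gives δ_{j,n}. Both directions of the inverse relation then follow from
-- these orthogonality relations by exchanging the order of summation.
module Submission where

open import Defs
open import Level using (Level)
open import Data.Nat using (ℕ; zero; suc; _≤_; _<_; _≤′_; ≤′-refl; ≤′-step; z≤n; s≤s; _∸_; _!)
  renaming (_+_ to _+ℕ_)
open import Data.Nat.Properties as ℕ using (_≟_)
open import Data.Product using (_×_; _,_)
open import Function.Bundles using (_⇔_; mk⇔)
open import Relation.Binary.PropositionalEquality as ≡ using (_≡_; _≢_)
open import Relation.Nullary using (¬_; Dec; yes; no; contradiction)

module FiniteSums {c ℓ} (F : Char0Field c ℓ) where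
  open Char0Field F hiding (zero)
  open Theory F
  open import Relation.Binary.Reasoning.Setoid setoid
  open import Algebra.Solver.CommutativeMonoid +-commutativeMonoid using (solve; _⊕_; _⊜_)

  δ-diag : ∀ n → δ n n ≈ 1#
  δ-diag n with n ≟ n
  ... | yes _ = refl
  ... | no n≢n = contradiction ≡.refl n≢n

  δ-offdiag : ∀ {j n} → j ≢ n → δ j n ≈ 0#
  δ-offdiag {j} {n} j≢n with j ≟ n
  ... | yes j≡n = contradiction j≡n j≢n
  ... | no _ = refl

  δ-suc : ∀ j n → δ (suc j) (suc n) ≈ δ j n
  δ-suc j n = by-cases (j ≟ n)
    where
    by-cases : Dec (j ≡ n) → δ (suc j) (suc n) ≈ δ j n
    by-cases (yes ≡.refl) = trans (δ-diag (suc j)) (sym (δ-diag j))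
    by-cases (no j≢n) = trans (δ-offdiag (λ sj≡sn → j≢n (ℕ.suc-injective sj≡sn))) (sym (δ-offdiag j≢n))

  sum-cong≤ : ∀ n {f g} → (∀ i → i ≤ n → f i ≈ g i) → sumUpTo n f ≈ sumUpTo n g
  sum-cong≤ zero f≈g = f≈g 0 z≤n
  sum-cong≤ (suc n) f≈g =
    +-cong (sum-cong≤ n (λ i i≤n → f≈g i (ℕ.m≤n⇒m≤1+n i≤n))) (f≈g (suc n) ℕ.≤-refl)

  sum-cong : ∀ n {f g} → (∀ i → f i ≈ g i) → sumUpTo n f ≈ sumUpTo n g
  sum-cong n f≈g = sum-cong≤ n (λ i _ → f≈g i)

  sum-≈0 : ∀ n {f} → (∀ i → i ≤ n → f i ≈ 0#) → sumUpTo n f ≈ 0#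
  sum-≈0 zero f≈0 = f≈0 0 z≤n
  sum-≈0 (suc n) f≈0 =
    trans (+-cong (sum-≈0 n (λ i i≤n → f≈0 i (ℕ.m≤n⇒m≤1+n i≤n))) (f≈0 (suc n) ℕ.≤-refl))
          (+-identityˡ 0#)

  sum-distrib-+ : ∀ n f g → sumUpTo n (λ i → f i + g i) ≈ sumUpTo n f + sumUpTo n g
  sum-distrib-+ zero f g = refl
  sum-distrib-+ (suc n) f g = begin
    sumUpTo n (λ i → f i + g i) + (f (suc n) + g (suc n))
      ≈⟨ +-congʳ (sum-distrib-+ n f g) ⟩
    (sumUpTo n f + sumUpTo n g) + (f (suc n) + g (suc n))
      ≈⟨ solve 4 (λ s t x y → (s ⊕ t) ⊕ (x ⊕ y) ⊜ (s ⊕ x) ⊕ (t ⊕ y)) refl _ _ _ _ ⟩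
    (sumUpTo n f + f (suc n)) + (sumUpTo n g + g (suc n)) ∎

  *-distribˡ-sum : ∀ n x f → x * sumUpTo n f ≈ sumUpTo n (λ i → x * f i)
  *-distribˡ-sum zero x f = refl
  *-distribˡ-sum (suc n) x f = trans (distribˡ x _ _) (+-congʳ (*-distribˡ-sum n x f))

  *-distribʳ-sum : ∀ n x f → sumUpTo n f * x ≈ sumUpTo n (λ i → f i * x)
  *-distribʳ-sum zero x f = refl
  *-distribʳ-sum (suc n) x f = trans (distribʳ x _ _) (+-congʳ (*-distribʳ-sum n x f))

  sum-head : ∀ n f → sumUpTo (suc n) f ≈ f 0 + sumUpTo n (λ i → f (suc i))
  sum-head zero f = refl
  sum-head (suc n) f = trans (+-congʳ (sum-head n f)) (+-assoc _ _ _)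

  sum≈head : ∀ n f → (∀ i → i < n → f (suc i) ≈ 0#) → sumUpTo n f ≈ f 0
  sum≈head zero f _ = refl
  sum≈head (suc n) f f≈0 =
    trans (sum-head n f) (trans (+-congˡ (sum-≈0 n (λ i i≤n → f≈0 i (s≤s i≤n)))) (+-identityʳ _))

  sum-comm : ∀ m n (G : ℕ → ℕ → Carrier) →
    sumUpTo m (λ i → sumUpTo n (G i)) ≈ sumUpTo n (λ k → sumUpTo m (λ i → G i k))
  sum-comm zero n G = refl
  sum-comm (suc m) n G = trans (+-congʳ (sum-comm m n G)) (sym (sum-distrib-+ n _ _))

  sum-reverse : ∀ n f → sumUpTo n f ≈ sumUpTo n (λ i → f (n ∸ i))
  sum-reverse zero f = refl
  sum-reverse (suc n) f = begin
    sumUpTo (suc n) f                            ≈⟨ sum-head n f ⟩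
    f 0 + sumUpTo n (λ i → f (suc i))            ≈⟨ +-congˡ (sum-reverse n (λ i → f (suc i))) ⟩
    f 0 + sumUpTo n (λ i → f (suc (n ∸ i)))      ≈⟨ +-comm _ _ ⟩
    sumUpTo n (λ i → f (suc (n ∸ i))) + f 0
      ≈⟨ +-cong (sum-cong≤ n (λ i i≤n → reflexive (≡.cong f (≡.sym (ℕ.+-∸-assoc 1 i≤n)))))
                (reflexive (≡.cong f (≡.sym (ℕ.n∸n≡0 n)))) ⟩
    sumUpTo (suc n) (λ i → f (suc n ∸ i)) ∎

  sum-extend : ∀ {m n} f → m ≤ n → (∀ k → m < k → k ≤ n → f k ≈ 0#) → sumUpTo m f ≈ sumUpTo n f
  sum-extend f m≤n = go (ℕ.≤⇒≤′ m≤n)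
    where
    go : ∀ {m n} → m ≤′ n → (∀ k → m < k → k ≤ n → f k ≈ 0#) → sumUpTo m f ≈ sumUpTo n f
    go ≤′-refl _ = refl
    go {m} (≤′-step {n} m≤′n) f≈0 = begin
      sumUpTo m f         ≈⟨ go m≤′n (λ k m<k k≤n → f≈0 k m<k (ℕ.m≤n⇒m≤1+n k≤n)) ⟩
      sumUpTo n f         ≈⟨ +-identityʳ _ ⟨
      sumUpTo n f + 0#    ≈⟨ +-congˡ (f≈0 (suc n) (s≤s (ℕ.≤′⇒≤ m≤′n)) ℕ.≤-refl) ⟨
      sumUpTo (suc n) f   ∎

  sum≈sumFromTo : ∀ {j n} f → j ≤ n → (∀ k → k < j → f k ≈ 0#) → sumUpTo n f ≈ sumFromTo j n f
  sum≈sumFromTo f z≤n _ = refl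
  sum≈sumFromTo {suc j} {suc n} f (s≤s j≤n) f≈0 = begin
    sumUpTo (suc n) f                      ≈⟨ sum-head n f ⟩
    f 0 + sumUpTo n (λ i → f (suc i))      ≈⟨ +-congʳ (f≈0 0 (s≤s z≤n)) ⟩
    0# + sumUpTo n (λ i → f (suc i))       ≈⟨ +-identityˡ _ ⟩
    sumUpTo n (λ i → f (suc i))
      ≈⟨ sum≈sumFromTo (λ i → f (suc i)) j≤n (λ k k<j → f≈0 (suc k) (s≤s k<j)) ⟩
    sumFromTo (suc j) (suc n) f            ∎

  sumFromTo-self : ∀ n f → sumFromTo n n f ≈ f n
  sumFromTo-self n f rewrite ℕ.n∸n≡0 n = reflexive (≡.cong f (ℕ.+-identityʳ n))

  sumFromTo-snoc : ∀ {j n} f → j ≤ n → sumFromTo j n f + f (suc n) ≈ sumFromTo j (suc n) f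
  sumFromTo-snoc {j} {n} f j≤n rewrite ℕ.+-∸-assoc 1 j≤n =
    +-congˡ (reflexive (≡.cong f (≡.sym j+[1+n-j]≡1+n)))
    where
    j+[1+n-j]≡1+n : j +ℕ suc (n ∸ j) ≡ suc n
    j+[1+n-j]≡1+n = ≡.trans (ℕ.+-suc j (n ∸ j)) (≡.cong suc (ℕ.m+[n∸m]≡n j≤n))

  sum-triangle : ∀ n (G : ℕ → ℕ → Carrier) →
    sumUpTo n (λ k → sumUpTo k (G k)) ≈ sumUpTo n (λ j → sumFromTo j n (λ k → G k j))
  sum-triangle zero G = refl
  sum-triangle (suc n) G = begin
    sumUpTo n (λ k → sumUpTo k (G k)) + (sumUpTo n (G (suc n)) + G (suc n) (suc n))
      ≈⟨ +-congʳ (sum-triangle n G) ⟩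
    sumUpTo n (λ j → sumFromTo j n (λ k → G k j)) + (sumUpTo n (G (suc n)) + G (suc n) (suc n))
      ≈⟨ +-assoc _ _ _ ⟨
    (sumUpTo n (λ j → sumFromTo j n (λ k → G k j)) + sumUpTo n (G (suc n))) + G (suc n) (suc n)
      ≈⟨ +-cong (sum-distrib-+ n _ _) (sumFromTo-self (suc n) (λ k → G k (suc n))) ⟨
    sumUpTo n (λ j → sumFromTo j n (λ k → G k j) + G (suc n) j) + sumFromTo (suc n) (suc n) (λ k → G k (suc n))
      ≈⟨ +-congʳ (sum-cong≤ n (λ j j≤n → sumFromTo-snoc (λ k → G k j) j≤n)) ⟩
    sumUpTo (suc n) (λ j → sumFromTo j (suc n) (λ k → G k j)) ∎

  sum-*δ : ∀ n (f : ℕ → Carrier) → sumUpTo n (λ k → f k * δ k n) ≈ f n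
  sum-*δ zero f = trans (*-congˡ (δ-diag 0)) (*-identityʳ _)
  sum-*δ (suc n) f = begin
    sumUpTo n (λ k → f k * δ k (suc n)) + f (suc n) * δ (suc n) (suc n)
      ≈⟨ +-cong (sum-≈0 n (λ k k≤n → trans (*-congˡ (δ-offdiag (ℕ.<⇒≢ (s≤s k≤n)))) (zeroʳ _)))
                (trans (*-congˡ (δ-diag (suc n))) (*-identityʳ _)) ⟩
    0# + f (suc n) ≈⟨ +-identityˡ _ ⟩
    f (suc n) ∎

module PowerSeries {c ℓ} (F : Char0Field c ℓ) where
  open Char0Field F hiding (zero)
  open Theory F
  open FiniteSums F
  open import Algebra.Bundles using (CommutativeMonoid)
  open import Algebra.Structures using (IsCommutativeMonoid)
  import Relation.Binary.Reasoning.Setoid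
  open Relation.Binary.Reasoning.Setoid setoid

  infix 4 _≋_
  _≋_ : PS → PS → Set ℓ
  f ≋ g = ∀ n → f n ≈ g n

  ⊛-cong : ∀ {f f′ g g′} → f ≋ f′ → g ≋ g′ → (f ⊛ g) ≋ (f′ ⊛ g′)
  ⊛-cong f≋f′ g≋g′ n = sum-cong n (λ i → *-cong (f≋f′ i) (g≋g′ (n ∸ i)))

  ⊛-comm : ∀ f g → (f ⊛ g) ≋ (g ⊛ f)
  ⊛-comm f g n = begin
    sumUpTo n (λ i → f i * g (n ∸ i))              ≈⟨ sum-reverse n _ ⟩
    sumUpTo n (λ i → f (n ∸ i) * g (n ∸ (n ∸ i)))
      ≈⟨ sum-cong≤ n (λ i i≤n → trans (*-comm _ _) (*-congʳ (reflexive (≡.cong g (ℕ.m∸[m∸n]≡n i≤n))))) ⟩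
    sumUpTo n (λ i → g i * f (n ∸ i))              ∎

  ⊛-assoc : ∀ f g h → ((f ⊛ g) ⊛ h) ≋ (f ⊛ (g ⊛ h))
  ⊛-assoc f g h n = begin
    sumUpTo n (λ i → sumUpTo i (λ j → f j * g (i ∸ j)) * h (n ∸ i))
      ≈⟨ sum-cong n (λ i → *-distribʳ-sum i _ _) ⟩
    sumUpTo n (λ i → sumUpTo i (λ j → (f j * g (i ∸ j)) * h (n ∸ i)))
      ≈⟨ sum-triangle n _ ⟩
    sumUpTo n (λ j → sumUpTo (n ∸ j) (λ l → (f j * g ((j +ℕ l) ∸ j)) * h (n ∸ (j +ℕ l))))
      ≈⟨ sum-cong n (λ j → sum-cong (n ∸ j) (λ l → trans (*-assoc _ _ _) (*-congˡ (*-cong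
           (reflexive (≡.cong g (ℕ.m+n∸m≡n j l))) (reflexive (≡.cong h (≡.sym (ℕ.∸-+-assoc n j l)))))))) ⟩
    sumUpTo n (λ j → sumUpTo (n ∸ j) (λ l → f j * (g l * h (n ∸ j ∸ l))))
      ≈⟨ sum-cong n (λ j → *-distribˡ-sum (n ∸ j) (f j) _) ⟨
    sumUpTo n (λ j → f j * sumUpTo (n ∸ j) (λ l → g l * h (n ∸ j ∸ l))) ∎

  ⊛-identityˡ : ∀ f → (one ⊛ f) ≋ f
  ⊛-identityˡ f n = trans (sum≈head n _ (λ _ _ → zeroˡ _)) (*-identityˡ _)

  ⊛-isCommutativeMonoid : IsCommutativeMonoid _≋_ _⊛_ one
  ⊛-isCommutativeMonoid = record
    { isMonoid = record
      { isSemigroup = record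
        { isMagma = record
          { isEquivalence = record
            { refl = λ _ → refl
            ; sym = λ f≋g n → sym (f≋g n)
            ; trans = λ f≋g g≋h n → trans (f≋g n) (g≋h n)
            }
          ; ∙-cong = ⊛-cong
          }
        ; assoc = ⊛-assoc
        }
      ; identity = ⊛-identityˡ , λ f n → trans (⊛-comm f one n) (⊛-identityˡ f n)
      }
    ; comm = ⊛-comm
    }

  ⊛-commutativeMonoid : CommutativeMonoid c ℓ
  ⊛-commutativeMonoid = record { isCommutativeMonoid = ⊛-isCommutativeMonoid }

  open CommutativeMonoid ⊛-commutativeMonoid public
    using () renaming (refl to ≋-refl; sym to ≋-sym; trans to ≋-trans; identityʳ to ⊛-identityʳ)
  open import Algebra.Properties.CommutativeSemigroup
    (CommutativeMonoid.commutativeSemigroup ⊛-commutativeMonoid) using (interchange)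
  module ≋-Reasoning = Relation.Binary.Reasoning.Setoid (CommutativeMonoid.setoid ⊛-commutativeMonoid)

  ^^-cong : ∀ {f g} → f ≋ g → ∀ k → (f ^^ k) ≋ (g ^^ k)
  ^^-cong f≋g zero = ≋-refl
  ^^-cong f≋g (suc k) = ⊛-cong f≋g (^^-cong f≋g k)

  ^^-+ : ∀ f i j → (f ^^ (i +ℕ j)) ≋ ((f ^^ i) ⊛ (f ^^ j))
  ^^-+ f zero j = ≋-sym (⊛-identityˡ (f ^^ j))
  ^^-+ f (suc i) j = ≋-trans (⊛-cong ≋-refl (^^-+ f i j)) (≋-sym (⊛-assoc f (f ^^ i) (f ^^ j)))

  ^^-distrib-⊛ : ∀ f g k → ((f ⊛ g) ^^ k) ≋ ((f ^^ k) ⊛ (g ^^ k))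
  ^^-distrib-⊛ f g zero = ≋-sym (⊛-identityˡ one)
  ^^-distrib-⊛ f g (suc k) = ≋-trans (⊛-cong ≋-refl (^^-distrib-⊛ f g k)) (interchange f g (f ^^ k) (g ^^ k))

  one-^^ : ∀ k → (one ^^ k) ≋ one
  one-^^ zero = ≋-refl
  one-^^ (suc k) = ≋-trans (⊛-cong ≋-refl (one-^^ k)) (⊛-identityˡ one)

  ^^-coeff-below : ∀ {h} → h 0 ≈ 0# → ∀ k n → n < k → (h ^^ k) n ≈ 0#
  ^^-coeff-below {h} h₀≈0 (suc k) n (s≤s n≤k) = sum-≈0 n (term n n≤k)
    where
    term : ∀ n → n ≤ k → ∀ i → i ≤ n → h i * (h ^^ k) (n ∸ i) ≈ 0#
    term n _ zero _ = trans (*-congʳ h₀≈0) (zeroˡ _)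
    term (suc n) n<k (suc i) _ =
      trans (*-congˡ (^^-coeff-below h₀≈0 k (n ∸ i) (ℕ.≤-<-trans (ℕ.m∸n≤m n i) n<k))) (zeroʳ _)

  ⊛-coeff-below : ∀ {f} g {j} → (∀ i → i < j → f i ≈ 0#) → ∀ n → n < j → (f ⊛ g) n ≈ 0#
  ⊛-coeff-below g f≈0 n n<j =
    sum-≈0 n (λ i i≤n → trans (*-congʳ (f≈0 i (ℕ.≤-<-trans i≤n n<j))) (zeroˡ _))

  X-⊛ : ∀ f n → (X ⊛ f) (suc n) ≈ f n
  X-⊛ f n = begin
    sumUpTo (suc n) (λ i → X i * f (suc n ∸ i))            ≈⟨ sum-head n _ ⟩
    0# * f (suc n) + sumUpTo n (λ i → X (suc i) * f (n ∸ i)) ≈⟨ trans (+-congʳ (zeroˡ _)) (+-identityˡ _) ⟩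
    sumUpTo n (λ i → X (suc i) * f (n ∸ i))                ≈⟨ sum≈head n _ (λ _ _ → zeroˡ _) ⟩
    1# * f n                                               ≈⟨ *-identityˡ _ ⟩
    f n                                                    ∎

  X-^^ : ∀ k n → (X ^^ k) n ≈ δ k n
  X-^^ zero zero = sym (δ-diag 0)
  X-^^ zero (suc n) = sym (δ-offdiag {0} {suc n} (λ ()))
  X-^^ (suc k) zero = trans (zeroˡ _) (sym (δ-offdiag {suc k} {0} (λ ())))
  X-^^ (suc k) (suc n) = trans (X-⊛ (X ^^ k) n) (trans (X-^^ k n) (sym (δ-suc k n)))

module Composition {c ℓ} (F : Char0Field c ℓ) where
  open Char0Field F hiding (zero)
  open Theory F
  open FiniteSums F
  open PowerSeries F
  open import Algebra.Bundles using (CommutativeMonoid)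
  open import Algebra.Properties.CommutativeSemigroup
    (CommutativeMonoid.commutativeSemigroup *-commutativeMonoid) using () renaming (interchange to *-interchange)
  open import Relation.Binary.Reasoning.Setoid setoid

  ∘ₛ-congˡ : ∀ {f g} h → f ≋ g → (f ∘ₛ h) ≋ (g ∘ₛ h)
  ∘ₛ-congˡ h f≋g n = sum-cong n (λ k → *-congʳ (f≋g k))

  ∘ₛ-congʳ : ∀ f {g h} → g ≋ h → (f ∘ₛ g) ≋ (f ∘ₛ h)
  ∘ₛ-congʳ f g≋h n = sum-cong n (λ k → *-congˡ (^^-cong g≋h k n))

  one-∘ₛ : ∀ h → (one ∘ₛ h) ≋ one
  one-∘ₛ h n = trans (sum≈head n _ (λ _ _ → zeroˡ _)) (*-identityˡ _)

  ∘ₛ-X : ∀ f → (f ∘ₛ X) ≋ f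
  ∘ₛ-X f n = trans (sum-cong n (λ k → *-congˡ (X-^^ k n))) (sum-*δ n f)

  ∘ₛ-coeff : ∀ {h} → h 0 ≈ 0# → ∀ f {m n} → m ≤ n →
    (f ∘ₛ h) m ≈ sumUpTo n (λ k → f k * (h ^^ k) m)
  ∘ₛ-coeff h₀≈0 f m≤n =
    sum-extend _ m≤n (λ k m<k _ → trans (*-congˡ (^^-coeff-below h₀≈0 k _ m<k)) (zeroʳ _))

  ∘ₛ-distrib-⊛ : ∀ u v {h} → h 0 ≈ 0# → ((u ⊛ v) ∘ₛ h) ≋ ((u ∘ₛ h) ⊛ (v ∘ₛ h))
  ∘ₛ-distrib-⊛ u v {h} h₀≈0 n = trans lhs (sym rhs)
    where
    H : ℕ → ℕ → Carrier
    H k m = (h ^^ k) m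
    triple : Carrier
    triple = sumUpTo n (λ i → sumUpTo n (λ l → sumUpTo n (λ m → (u i * v l) * (H i m * H l (n ∸ m)))))
    n<i+l : ∀ i l → n ∸ i < l → n < i +ℕ l
    n<i+l i l n∸i<l = ℕ.≤-<-trans (ℕ.m≤n+m∸n n i) (ℕ.+-monoʳ-< i n∸i<l)
    lhs : ((u ⊛ v) ∘ₛ h) n ≈ triple
    lhs = begin
      sumUpTo n (λ k → sumUpTo k (λ i → u i * v (k ∸ i)) * H k n)
        ≈⟨ sum-cong n (λ k → *-distribʳ-sum k _ _) ⟩
      sumUpTo n (λ k → sumUpTo k (λ i → (u i * v (k ∸ i)) * H k n))
        ≈⟨ sum-triangle n _ ⟩
      sumUpTo n (λ i → sumUpTo (n ∸ i) (λ l → (u i * v ((i +ℕ l) ∸ i)) * H (i +ℕ l) n))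
        ≈⟨ sum-cong n (λ i → sum-cong (n ∸ i) (λ l → *-congʳ (*-congˡ (reflexive (≡.cong v (ℕ.m+n∸m≡n i l)))))) ⟩
      sumUpTo n (λ i → sumUpTo (n ∸ i) (λ l → (u i * v l) * H (i +ℕ l) n))
        ≈⟨ sum-cong n (λ i → sum-extend _ (ℕ.m∸n≤m n i) (λ l n∸i<l _ →
             trans (*-congˡ (^^-coeff-below h₀≈0 (i +ℕ l) n (n<i+l i l n∸i<l))) (zeroʳ _))) ⟩
      sumUpTo n (λ i → sumUpTo n (λ l → (u i * v l) * H (i +ℕ l) n))
        ≈⟨ sum-cong n (λ i → sum-cong n (λ l → trans (*-congˡ (^^-+ h i l n)) (*-distribˡ-sum n _ _))) ⟩
      triple ∎
    rhs : ((u ∘ₛ h) ⊛ (v ∘ₛ h)) n ≈ triple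
    rhs = begin
      sumUpTo n (λ m → (u ∘ₛ h) m * (v ∘ₛ h) (n ∸ m))
        ≈⟨ sum-cong≤ n (λ m m≤n → *-cong (∘ₛ-coeff h₀≈0 u m≤n) (∘ₛ-coeff h₀≈0 v (ℕ.m∸n≤m n m))) ⟩
      sumUpTo n (λ m → sumUpTo n (λ i → u i * H i m) * sumUpTo n (λ l → v l * H l (n ∸ m)))
        ≈⟨ sum-cong n (λ m → trans (*-distribʳ-sum n _ _) (sum-cong n (λ i → *-distribˡ-sum n _ _))) ⟩
      sumUpTo n (λ m → sumUpTo n (λ i → sumUpTo n (λ l → (u i * H i m) * (v l * H l (n ∸ m)))))
        ≈⟨ trans (sum-comm n n _) (sum-cong n (λ i → sum-comm n n _)) ⟩
      sumUpTo n (λ i → sumUpTo n (λ l → sumUpTo n (λ m → (u i * H i m) * (v l * H l (n ∸ m)))))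
        ≈⟨ sum-cong n (λ i → sum-cong n (λ l → sum-cong n (λ m → *-interchange _ _ _ _))) ⟩
      triple ∎

  ∘ₛ-distrib-^^ : ∀ f {h} → h 0 ≈ 0# → ∀ k → ((f ^^ k) ∘ₛ h) ≋ ((f ∘ₛ h) ^^ k)
  ∘ₛ-distrib-^^ f {h} h₀≈0 zero = one-∘ₛ h
  ∘ₛ-distrib-^^ f h₀≈0 (suc k) =
    ≋-trans (∘ₛ-distrib-⊛ f (f ^^ k) h₀≈0) (⊛-cong ≋-refl (∘ₛ-distrib-^^ f h₀≈0 k))

  ∘ₛ-assoc : ∀ f {g h} → g 0 ≈ 0# → h 0 ≈ 0# → ((f ∘ₛ g) ∘ₛ h) ≋ (f ∘ₛ (g ∘ₛ h))
  ∘ₛ-assoc f {g} {h} g₀≈0 h₀≈0 n = begin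
    sumUpTo n (λ m → (f ∘ₛ g) m * (h ^^ m) n)
      ≈⟨ sum-cong≤ n (λ m m≤n → *-congʳ (∘ₛ-coeff g₀≈0 f m≤n)) ⟩
    sumUpTo n (λ m → sumUpTo n (λ k → f k * (g ^^ k) m) * (h ^^ m) n)
      ≈⟨ sum-cong n (λ m → *-distribʳ-sum n _ _) ⟩
    sumUpTo n (λ m → sumUpTo n (λ k → (f k * (g ^^ k) m) * (h ^^ m) n))
      ≈⟨ sum-comm n n _ ⟩
    sumUpTo n (λ k → sumUpTo n (λ m → (f k * (g ^^ k) m) * (h ^^ m) n))
      ≈⟨ sum-cong n (λ k → trans (sum-cong n (λ m → *-assoc _ _ _)) (sym (*-distribˡ-sum n (f k) _))) ⟩
    sumUpTo n (λ k → f k * ((g ^^ k) ∘ₛ h) n)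
      ≈⟨ sum-cong n (λ k → *-congˡ (∘ₛ-distrib-^^ g h₀≈0 k n)) ⟩
    sumUpTo n (λ k → f k * ((g ∘ₛ h) ^^ k) n) ∎

  ∘ₛ-⊛-expand : ∀ f {h} → h 0 ≈ 0# → ∀ g n →
    sumUpTo n (λ k → f k * ((h ^^ k) ⊛ g) n) ≈ ((f ∘ₛ h) ⊛ g) n
  ∘ₛ-⊛-expand f {h} h₀≈0 g n = sym (begin
    sumUpTo n (λ i → (f ∘ₛ h) i * g (n ∸ i))
      ≈⟨ sum-cong≤ n (λ i i≤n → *-congʳ (∘ₛ-coeff h₀≈0 f i≤n)) ⟩
    sumUpTo n (λ i → sumUpTo n (λ k → f k * (h ^^ k) i) * g (n ∸ i))
      ≈⟨ sum-cong n (λ i → *-distribʳ-sum n _ _) ⟩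
    sumUpTo n (λ i → sumUpTo n (λ k → (f k * (h ^^ k) i) * g (n ∸ i)))
      ≈⟨ sum-comm n n _ ⟩
    sumUpTo n (λ k → sumUpTo n (λ i → (f k * (h ^^ k) i) * g (n ∸ i)))
      ≈⟨ sum-cong n (λ k → trans (sum-cong n (λ i → *-assoc _ _ _)) (sym (*-distribˡ-sum n (f k) _))) ⟩
    sumUpTo n (λ k → f k * ((h ^^ k) ⊛ g) n) ∎)

module InverseSeries {c ℓ} (F : Char0Field c ℓ) where
  open Char0Field F hiding (zero)
  open Theory F
  open PowerSeries F
  open Composition F
  open ≋-Reasoning

  reciprocal-∘ₛ : ∀ {A Ā B C} → A 0 ≈ 0# → Ā 0 ≈ 0# →
    (Ā ∘ₛ A) ≋ X → (C ⊛ (B ∘ₛ Ā)) ≋ one → (B ⊛ (C ∘ₛ A)) ≋ one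
  reciprocal-∘ₛ {A} {Ā} {B} {C} A₀≈0 Ā₀≈0 Ā∘A≋X C⊛B∘Ā≋one = begin
    B ⊛ (C ∘ₛ A)                  ≈⟨ ⊛-comm B (C ∘ₛ A) ⟩
    (C ∘ₛ A) ⊛ B                  ≈⟨ ⊛-cong ≋-refl (∘ₛ-X B) ⟨
    (C ∘ₛ A) ⊛ (B ∘ₛ X)           ≈⟨ ⊛-cong ≋-refl (∘ₛ-congʳ B Ā∘A≋X) ⟨
    (C ∘ₛ A) ⊛ (B ∘ₛ (Ā ∘ₛ A))    ≈⟨ ⊛-cong ≋-refl (∘ₛ-assoc B Ā₀≈0 A₀≈0) ⟨
    (C ∘ₛ A) ⊛ ((B ∘ₛ Ā) ∘ₛ A)    ≈⟨ ∘ₛ-distrib-⊛ C (B ∘ₛ Ā) A₀≈0 ⟨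
    (C ⊛ (B ∘ₛ Ā)) ∘ₛ A           ≈⟨ ∘ₛ-congˡ A C⊛B∘Ā≋one ⟩
    one ∘ₛ A                      ≈⟨ one-∘ₛ A ⟩
    one                           ∎

  inverse-series-cancel : ∀ {A Ā B C} → A 0 ≈ 0# → (Ā ∘ₛ A) ≋ X → (B ⊛ (C ∘ₛ A)) ≋ one →
    ∀ j r → ((((Ā ^^ j) ⊛ (C ^^ r)) ∘ₛ A) ⊛ (B ^^ r)) ≋ (X ^^ j)
  inverse-series-cancel {A} {Ā} {B} {C} A₀≈0 Ā∘A≋X B⊛C∘A≋one j r = begin
    (((Ā ^^ j) ⊛ (C ^^ r)) ∘ₛ A) ⊛ (B ^^ r)
      ≈⟨ ⊛-cong (∘ₛ-distrib-⊛ (Ā ^^ j) (C ^^ r) A₀≈0) (≋-refl {B ^^ r}) ⟩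
    (((Ā ^^ j) ∘ₛ A) ⊛ ((C ^^ r) ∘ₛ A)) ⊛ (B ^^ r)
      ≈⟨ ⊛-cong (⊛-cong (∘ₛ-distrib-^^ Ā A₀≈0 j) (∘ₛ-distrib-^^ C A₀≈0 r)) (≋-refl {B ^^ r}) ⟩
    (((Ā ∘ₛ A) ^^ j) ⊛ ((C ∘ₛ A) ^^ r)) ⊛ (B ^^ r)
      ≈⟨ ⊛-assoc ((Ā ∘ₛ A) ^^ j) ((C ∘ₛ A) ^^ r) (B ^^ r) ⟩
    ((Ā ∘ₛ A) ^^ j) ⊛ (((C ∘ₛ A) ^^ r) ⊛ (B ^^ r))
      ≈⟨ ⊛-cong (^^-cong Ā∘A≋X j) (≋-trans (⊛-comm _ _) (≋-sym (^^-distrib-⊛ B (C ∘ₛ A) r))) ⟩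
    (X ^^ j) ⊛ ((B ⊛ (C ∘ₛ A)) ^^ r)
      ≈⟨ ⊛-cong ≋-refl (≋-trans (^^-cong B⊛C∘A≋one r) (one-^^ r)) ⟩
    (X ^^ j) ⊛ one
      ≈⟨ ⊛-identityʳ (X ^^ j) ⟩
    X ^^ j ∎

module BellInversion {c ℓ} (F : Char0Field c ℓ) where
  open Char0Field F hiding (zero)
  open Theory F
  open FiniteSums F
  open PowerSeries F
  open Composition F
  open InverseSeries F
  open import Algebra.Solver.CommutativeMonoid *-commutativeMonoid using (solve; _⊕_; _⊜_)
  open import Relation.Binary.Reasoning.Setoid setoid

  lowerTriangular-inverse : ∀ (P Q : ℕ → ℕ → Carrier) →
    (∀ j n → j ≤ n → sumFromTo j n (λ k → P n k * Q k j) ≈ δ j n) →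
    ∀ (U V : ℕ → Carrier) → (∀ n → V n ≈ sumUpTo n (λ k → Q n k * U k)) →
    ∀ n → U n ≈ sumUpTo n (λ k → P n k * V k)
  lowerTriangular-inverse P Q PQ≈δ U V V≈QU n = sym (begin
    sumUpTo n (λ k → P n k * V k)
      ≈⟨ sum-cong n (λ k → *-congˡ (V≈QU k)) ⟩
    sumUpTo n (λ k → P n k * sumUpTo k (λ j → Q k j * U j))
      ≈⟨ sum-cong n (λ k → *-distribˡ-sum k _ _) ⟩
    sumUpTo n (λ k → sumUpTo k (λ j → P n k * (Q k j * U j)))
      ≈⟨ sum-triangle n _ ⟩
    sumUpTo n (λ j → sumFromTo j n (λ k → P n k * (Q k j * U j)))
      ≈⟨ sum-cong n (λ j → trans (sum-cong (n ∸ j) (λ _ → sym (*-assoc _ _ _)))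
                                 (sym (*-distribʳ-sum (n ∸ j) _ _))) ⟩
    sumUpTo n (λ j → sumFromTo j n (λ k → P n k * Q k j) * U j)
      ≈⟨ sum-cong≤ n (λ j j≤n → trans (*-congʳ (PQ≈δ j n j≤n)) (*-comm _ _)) ⟩
    sumUpTo n (λ j → U j * δ j n)
      ≈⟨ sum-*δ n U ⟩
    U n ∎)

  ι-!-invFact : ∀ k → ι (k !) * invFact k ≈ 1#
  ι-!-invFact k = ⁻¹-inverse _ (ι-nonzero (ℕ.1≤n! k))
    where
    ι-nonzero : ∀ {m} → 0 < m → ¬ (ι m ≈ 0#)
    ι-nonzero {suc m} _ = char0 m

  bellR-vanish : ∀ r a b {n k} → n < k → bellR r a b n k ≈ 0#
  bellR-vanish r a b {n} {k} n<k =
    trans (*-congˡ (trans (*-congˡ coeff≈0) (zeroʳ _))) (zeroʳ _)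
    where
    coeff≈0 : ((egfA a ^^ k) ⊛ (egfB b ^^ r)) n ≈ 0#
    coeff≈0 = ⊛-coeff-below (egfB b ^^ r) (λ i i<k → ^^-coeff-below refl k i i<k) n n<k

  sum-bellR-product : ∀ r a b ā cc j n →
    sumUpTo n (λ k → bellR r a b n k * bellR r ā cc k j)
      ≈ (ι (n !) * invFact j) * ((((egfA ā ^^ j) ⊛ (egfB cc ^^ r)) ∘ₛ egfA a) ⊛ (egfB b ^^ r)) n
  sum-bellR-product r a b ā cc j n = begin
    sumUpTo n (λ k → bellR r a b n k * bellR r ā cc k j)
      ≈⟨ sum-cong n regroup ⟩
    sumUpTo n (λ k → K * (Q k * ((A ^^ k) ⊛ Bʳ) n))
      ≈⟨ *-distribˡ-sum n K _ ⟨
    K * sumUpTo n (λ k → Q k * ((A ^^ k) ⊛ Bʳ) n)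
      ≈⟨ *-congˡ (∘ₛ-⊛-expand Q refl Bʳ n) ⟩
    K * ((Q ∘ₛ A) ⊛ Bʳ) n ∎
    where
    A Bʳ Q : PS
    A = egfA a
    Bʳ = egfB b ^^ r
    Q = (egfA ā ^^ j) ⊛ (egfB cc ^^ r)
    K : Carrier
    K = ι (n !) * invFact j
    regroup : ∀ k → bellR r a b n k * bellR r ā cc k j ≈ K * (Q k * ((A ^^ k) ⊛ Bʳ) n)
    regroup k = begin
      (ι (n !) * (invFact k * P)) * (ι (k !) * (invFact j * Q k))
        ≈⟨ solve 6 (λ x y p z w q → (x ⊕ (y ⊕ p)) ⊕ (z ⊕ (w ⊕ q)) ⊜ ((x ⊕ w) ⊕ (q ⊕ p)) ⊕ (z ⊕ y))
                   refl (ι (n !)) (invFact k) P (ι (k !)) (invFact j) (Q k) ⟩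
      (K * (Q k * P)) * (ι (k !) * invFact k)
        ≈⟨ *-congˡ (ι-!-invFact k) ⟩
      (K * (Q k * P)) * 1#
        ≈⟨ *-identityʳ _ ⟩
      K * (Q k * P) ∎
      where
      P : Carrier
      P = ((A ^^ k) ⊛ Bʳ) n

  ι-!-invFact-δ : ∀ j n → (ι (n !) * invFact j) * δ j n ≈ δ j n
  ι-!-invFact-δ j n with j ≟ n
  ... | yes ≡.refl = trans (*-congʳ (ι-!-invFact j)) (*-identityˡ _)
  ... | no _ = zeroʳ _

  bellR-orthogonal : ∀ r (a b ā cc : ℕ → Carrier) →
    (egfA ā ∘ₛ egfA a) ≋ X → (egfB b ⊛ (egfB cc ∘ₛ egfA a)) ≋ one →
    ∀ j n → j ≤ n → sumFromTo j n (λ k → bellR r a b n k * bellR r ā cc k j) ≈ δ j n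
  bellR-orthogonal r a b ā cc Ā∘A≋X B⊛C∘A≋one j n j≤n = begin
    sumFromTo j n G
      ≈⟨ sum≈sumFromTo G j≤n (λ k k<j → trans (*-congˡ (bellR-vanish r ā cc k<j)) (zeroʳ _)) ⟨
    sumUpTo n G
      ≈⟨ sum-bellR-product r a b ā cc j n ⟩
    K * ((((egfA ā ^^ j) ⊛ (egfB cc ^^ r)) ∘ₛ egfA a) ⊛ (egfB b ^^ r)) n
      ≈⟨ *-congˡ (inverse-series-cancel refl Ā∘A≋X B⊛C∘A≋one j r n) ⟩
    K * (X ^^ j) n
      ≈⟨ *-congˡ (X-^^ j n) ⟩
    K * δ j n
      ≈⟨ ι-!-invFact-δ j n ⟩
    δ j n ∎
    where
    G : ℕ → Carrier
    G k = bellR r a b n k * bellR r ā cc k j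
    K : Carrier
    K = ι (n !) * invFact j

theorem1 : ∀ {c ℓ : Level} (F : Char0Field c ℓ) →
    let open Char0Field F
        open Theory F
    in (r : ℕ) (a b ā cc : ℕ → Carrier) →
       ¬ (a 1 ≈ 0#) →
       ¬ (b 1 ≈ 0#) →
       -- Ā is the compositional inverse of A
       (∀ n → (egfA a ∘ₛ egfA ā) n ≈ X n) →
       (∀ n → (egfA ā ∘ₛ egfA a) n ≈ X n) →
       -- Σ_{j≥0} c_{j+1} t^j / j! = (B(Ā(t)))⁻¹
       (∀ n → (egfB cc ⊛ (egfB b ∘ₛ egfA ā)) n ≈ one n) →
       ((∀ (U V : ℕ → Carrier) →
           (∀ n → U n ≈ sumUpTo n (λ k → bellR r a b n k * V k))
         ⇔ (∀ n → V n ≈ sumUpTo n (λ k → bellR r ā cc n k * U k)))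
       × (∀ j n → j ≤ n →
           sumFromTo j n (λ k → bellR r a b n k * bellR r ā cc k j) ≈ δ j n))
theorem1 F r a b ā cc _ _ A∘Ā≋X Ā∘A≋X C⊛B∘Ā≋one =
  (λ U V → mk⇔ (lowerTriangular-inverse (bellR r ā cc) (bellR r a b) ācc-orthogonal V U)
               (lowerTriangular-inverse (bellR r a b) (bellR r ā cc) ab-orthogonal U V))
  , ab-orthogonal
  where
  open Char0Field F using (_≈_; _*_; refl)
  open Theory F using (bellR; sumFromTo; δ)
  open BellInversion F
  open InverseSeries F using (reciprocal-∘ₛ)
  ab-orthogonal : ∀ j n → j ≤ n → sumFromTo j n (λ k → bellR r a b n k * bellR r ā cc k j) ≈ δ j n
  ab-orthogonal = bellR-orthogonal r a b ā cc Ā∘A≋X (reciprocal-∘ₛ refl refl Ā∘A≋X C⊛B∘Ā≋one)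
  ācc-orthogonal : ∀ j n → j ≤ n → sumFromTo j n (λ k → bellR r ā cc n k * bellR r a b k j) ≈ δ j n
  ācc-orthogonal = bellR-orthogonal r ā cc a b A∘Ā≋X C⊛B∘Ā≋one
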